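{- For all $n\geq 0$, $s_{n+1}D_{n-k+1}=s_nD_n$, and hence $|D_n|-|D_{n-k+1}|=|s_{n+1}|-|s_n|$.
   Context: Fix $k\geq 2$, letters $a_1,\dots,a_k$ and positive integers $(d_i)_{i\geq1}$. Define $s_{1-k}=a_2,\dots,s_{ -1}=a_k,s_0=a_1$; $s_n=s_{n-1}^{d_n}\cdots s_0^{d_1}a_{n+1}$ for $1\leq n\leq k-1$; $s_n=s_{n-1}^{d_n}\cdots s_{n-k+1}^{d_{n-k+2}}s_{n-k}$ for $n\geq k$. Define $D_0=a_1^{d_1-1}$, $D_m=s_m^{d_{m+1}-1}s_{m-1}^{d_m}\cdots s_1^{d_2}s_0^{d_1}$ for $m\geq1$, and formally $D_{ -j}=a_{k+1-j}^{ -1}$ with $|D_{ -j}|=-1$ for $1\leq j\leq k$. Products involving inverse letters are computed in the free group on $\{a_1,\dots,a_k\}$. -}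

module Defs where

open import Data.Bool using (Bool; true; false; if_then_else_; _∧_)
open import Data.Nat using (ℕ; zero; suc; _∸_; _<ᵇ_; _≡ᵇ_; pred)
open import Data.List using (List; []; _∷_; _++_; concat; replicate; take; drop; map; length)
open import Data.Product using (_×_; _,_)
open import Data.Integer using (ℤ; +_; -[1+_])
open import Relation.Binary.PropositionalEquality using (_≡_)

-- Positive words: the letter a_i is encoded by the natural number i.
Word : Set
Word = List ℕ

pow : Word → ℕ → Word
pow w e = concat (replicate e w)

powers : (ℕ → ℕ) → ℕ → List Word → Word
powers d j []       = []
powers d j (w ∷ ws) = pow w (d j) ++ powers d (pred j) ws

-- hist k d n = [s_n, s_{n-1}, ..., s_0]
hist : ℕ → (ℕ → ℕ) → ℕ → List Word
hist k d zero    = (1 ∷ []) ∷ []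
hist k d (suc n) = step ∷ h
  where
  h : List Word
  h = hist k d n
  step : Word
  step = if suc n <ᵇ k
         then powers d (suc n) h ++ (suc (suc n) ∷ [])
         else powers d (suc n) (take (k ∸ 1) h) ++ concat (take 1 (drop (k ∸ 1) h))

s : ℕ → (ℕ → ℕ) → ℕ → Word
s k d n = concat (take 1 (hist k d n))

D : ℕ → (ℕ → ℕ) → ℕ → Word
D k d m = pow (s k d m) (d (suc m) ∸ 1) ++ powers d m (drop 1 (hist k d m))

-- Words in the free group: (true , i) = a_i, (false , i) = a_i⁻¹
FWord : Set
FWord = List (Bool × ℕ)

pos : Word → FWord
pos = map (λ i → (true , i))

inverseLetters : Bool × ℕ → Bool × ℕ → Bool
inverseLetters (true , i)  (false , j) = i ≡ᵇ j
inverseLetters (false , i) (true , j)  = i ≡ᵇ j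
inverseLetters _ _ = false

push : Bool × ℕ → FWord → FWord
push x []       = x ∷ []
push x (y ∷ ys) = if inverseLetters x y then ys else x ∷ y ∷ ys

reduce : FWord → FWord
reduce []       = []
reduce (x ∷ xs) = push x (reduce xs)

_≈FG_ : FWord → FWord → Set
u ≈FG v = reduce u ≡ reduce v

-- D_j for integer index j ≥ -k : D_{-J} = a_{k+1-J}⁻¹ (J = j'+1)
Dz : ℕ → (ℕ → ℕ) → ℤ → FWord
Dz k d (+ m)     = pos (D k d m)
Dz k d -[1+ j ]  = (false , k ∸ j) ∷ []

lenD : ℕ → (ℕ → ℕ) → ℤ → ℤ
lenD k d (+ m)    = + length (D k d m)
lenD k d -[1+ j ] = -[1+ 0 ]

-- The central observation is that D_n is exactly the tail of the product
-- defining s_{n+1}: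
--     s_n D_n = s_n^{d_{n+1}} s_{n-1}^{d_n} ... s_0^{d_1} =: P_n        (*)
-- The proof then splits according to the regime of the recurrence.
--   * Short regime (n+1 < k): s_{n+1} = P_n a_{n+2}, and n-k+1 < 0, so
--     D_{n-k+1} = a_{n+2}⁻¹ cancels against the final letter of s_{n+1}.
--   * Long regime (n+1 ≥ k, put j = n-k+1): s_{n+1} is the product of the
--     first k-1 factors of P_n followed by s_j, and by (*) for j we get
--     s_j D_j = s_j^{d_{j+1}} ... s_0^{d_1}, the remaining factors of P_n;
--     so s_{n+1} D_j = P_n = s_n D_n already as positive words.
-- In both cases the length identity is read off from the word identity.
module Submission where

open import Defs
open import Data.Nat using (ℕ; suc; _≤_)
open import Data.List using (_++_; length)
open import Data.Integer using (ℤ; +_; _-_; _+_; 1ℤ)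
open import Data.Product using (_×_)
open import Relation.Binary.PropositionalEquality using (_≡_)

open import Data.Bool using (true; false)
open import Data.List using (List; []; _∷_; take; drop; concat)
open import Data.Nat using (zero; _∸_; _<_; _<ᵇ_; _⊓_; s≤s; z≤n)
open import Data.Product using (_,_; Σ)
open import Data.Sum using (_⊎_; inj₁; inj₂)
open import Data.Unit using (tt)
open import Relation.Nullary using (contradiction)
open import Relation.Binary.PropositionalEquality
  using (refl; sym; trans; cong; cong₂; module ≡-Reasoning)
import Data.Nat as ℕ
import Data.Nat.Properties as ℕP
import Data.Integer as ℤ
import Data.Integer.Properties as ℤP
import Data.List.Properties as LP
open import Data.Integer.Tactic.RingSolver using (solve-∀)
open ≡-Reasoning

lengthDiff : ∀ (a b c e : ℤ) → c + a ≡ e + b → b - a ≡ c - e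
lengthDiff a b c e balance = begin
  b - a              ≡⟨ shift a b e ⟩
  (e + b) - (e + a)  ≡⟨ cong (_- (e + a)) (sym balance) ⟩
  (c + a) - (e + a)  ≡⟨ unshift a c e ⟩
  c - e              ∎
  where
  shift : ∀ (a b e : ℤ) → b - a ≡ (e + b) - (e + a)
  shift = solve-∀
  unshift : ∀ (a c e : ℤ) → (c + a) - (e + a) ≡ c - e
  unshift = solve-∀

-- (x + 1) + (-1) = x: the final letter of s_{n+1} against |D_{-J}| = -1.
succ-pred : ∀ (x : ℤ) → (x + 1ℤ) + ℤ.- 1ℤ ≡ x
succ-pred = solve-∀

shortIndex : ∀ n t → (+ n) - (+ suc (n ℕ.+ suc t)) + 1ℤ ≡ ℤ.-[1+ t ]
shortIndex n t
  rewrite ℤP.pos-+ 1 (n ℕ.+ suc t) | ℤP.pos-+ n (suc t) | ℤP.pos-+ 1 t = ring (+ n) (+ t)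
  where
  ring : ∀ (n t : ℤ) → n - (1ℤ + (n + (1ℤ + t))) + 1ℤ ≡ ℤ.- (1ℤ + t)
  ring = solve-∀

longIndex : ∀ k₁ j → (+ (k₁ ℕ.+ j)) - (+ suc k₁) + 1ℤ ≡ + j
longIndex k₁ j rewrite ℤP.pos-+ k₁ j | ℤP.pos-+ 1 k₁ = ring (+ k₁) (+ j)
  where
  ring : ∀ (a b : ℤ) → (a + b) - (1ℤ + a) + 1ℤ ≡ b
  ring = solve-∀

-- In the short regime the cancelling letter a_{k-t} is a_{n+2}.
shortLetter : ∀ n t → suc (n ℕ.+ suc t) ∸ t ≡ suc (suc n)
shortLetter n t = trans (cong (λ m → suc m ∸ t) (ℕP.+-suc n t)) (ℕP.m+n∸n≡m (suc (suc n)) t)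

splitAt : ∀ n k₁ → Σ ℕ (λ t → k₁ ≡ n ℕ.+ suc t) ⊎ Σ ℕ (λ j → n ≡ k₁ ℕ.+ j)
splitAt n       zero     = inj₂ (n , refl)
splitAt zero    (suc k₁) = inj₁ (k₁ , refl)
splitAt (suc n) (suc k₁) with splitAt n k₁
... | inj₁ (t , eq) = inj₁ (t , cong suc eq)
... | inj₂ (j , eq) = inj₂ (j , cong suc eq)

reduce-prefix : ∀ u w w′ → reduce w ≡ reduce w′ → reduce (u ++ w) ≡ reduce (u ++ w′)
reduce-prefix []      w w′ eq = eq
reduce-prefix (x ∷ u) w w′ eq = cong (push x) (reduce-prefix u w w′ eq)

cancel-suffix : ∀ u m → (u ++ (true , m) ∷ (false , m) ∷ []) ≈FG u
cancel-suffix u m = trans (reduce-prefix u _ [] (cancel-pair m)) (cong reduce (LP.++-identityʳ u))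
  where
  cancel-pair : ∀ m → reduce ((true , m) ∷ (false , m) ∷ []) ≡ []
  cancel-pair m with m ℕ.≡ᵇ m | ℕP.≡⇒≡ᵇ m m refl
  ... | true  | _ = refl
  ... | false | ()

fromWordIdentity : ∀ u x v y → u ++ x ≡ v ++ y →
  ((pos u ++ pos x) ≈FG (pos v ++ pos y))
  × (+ length y - + length x ≡ + length u - + length v)
fromWordIdentity u x v y eq = freeGroup , lengths
  where
  freeGroup : (pos u ++ pos x) ≈FG (pos v ++ pos y)
  freeGroup = cong reduce (begin
    pos u ++ pos x  ≡⟨ sym (LP.map-++ _ u x) ⟩
    pos (u ++ x)    ≡⟨ cong pos eq ⟩
    pos (v ++ y)    ≡⟨ LP.map-++ _ v y ⟩
    pos v ++ pos y  ∎)
  balance : + length u + + length x ≡ + length v + + length y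
  balance = begin
    + length u + + length x     ≡⟨ sym (ℤP.pos-+ (length u) (length x)) ⟩
    + (length u ℕ.+ length x)   ≡⟨ cong +_ (sym (LP.length-++ u)) ⟩
    + length (u ++ x)           ≡⟨ cong (λ w → + length w) eq ⟩
    + length (v ++ y)           ≡⟨ cong +_ (LP.length-++ v) ⟩
    + (length v ℕ.+ length y)   ≡⟨ ℤP.pos-+ (length v) (length y) ⟩
    + length v + + length y     ∎
  lengths : + length y - + length x ≡ + length u - + length v
  lengths = lengthDiff (+ length x) (+ length y) (+ length u) (+ length v) balance

fromLetterIdentity : ∀ u v y m → u ≡ (v ++ y) ++ m ∷ [] →
  ((pos u ++ (false , m) ∷ []) ≈FG (pos v ++ pos y))
  × (+ length y - ℤ.-[1+ 0 ] ≡ + length u - + length v)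
fromLetterIdentity u v y m eq = freeGroup , lengths
  where
  freeGroup : (pos u ++ (false , m) ∷ []) ≈FG (pos v ++ pos y)
  freeGroup = begin
    reduce (pos u ++ (false , m) ∷ [])
      ≡⟨ cong (λ w → reduce (w ++ (false , m) ∷ [])) (trans (cong pos eq) (LP.map-++ _ (v ++ y) _)) ⟩
    reduce ((pos (v ++ y) ++ (true , m) ∷ []) ++ (false , m) ∷ [])
      ≡⟨ cong reduce (LP.++-assoc (pos (v ++ y)) _ _) ⟩
    reduce (pos (v ++ y) ++ (true , m) ∷ (false , m) ∷ [])
      ≡⟨ cancel-suffix (pos (v ++ y)) m ⟩
    reduce (pos (v ++ y))
      ≡⟨ cong reduce (LP.map-++ _ v y) ⟩
    reduce (pos v ++ pos y) ∎
  balance : + length u + ℤ.-[1+ 0 ] ≡ + length v + + length y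
  balance = begin
    + length u + ℤ.-[1+ 0 ]               ≡⟨ cong (λ w → + length w + ℤ.-[1+ 0 ]) eq ⟩
    + length ((v ++ y) ++ m ∷ []) + ℤ.-[1+ 0 ]
      ≡⟨ cong (λ l → + l + ℤ.-[1+ 0 ]) (LP.length-++ (v ++ y)) ⟩
    + (length (v ++ y) ℕ.+ 1) + ℤ.-[1+ 0 ]
      ≡⟨ cong (_+ ℤ.-[1+ 0 ]) (ℤP.pos-+ (length (v ++ y)) 1) ⟩
    (+ length (v ++ y) + 1ℤ) + ℤ.- 1ℤ     ≡⟨ succ-pred _ ⟩
    + length (v ++ y)                     ≡⟨ cong +_ (LP.length-++ v) ⟩
    + (length v ℕ.+ length y)             ≡⟨ ℤP.pos-+ (length v) (length y) ⟩
    + length v + + length y               ∎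
  lengths : + length y - ℤ.-[1+ 0 ] ≡ + length u - + length v
  lengths = lengthDiff ℤ.-[1+ 0 ] (+ length y) (+ length u) (+ length v) balance

pow-unfold : ∀ (w : Word) e → 1 ≤ e → w ++ pow w (e ∸ 1) ≡ pow w e
pow-unfold w (suc e) _ = refl

powers-++ : ∀ (d : ℕ → ℕ) (A B : List Word) m →
  powers d (length A ℕ.+ m) (A ++ B) ≡ powers d (length A ℕ.+ m) A ++ powers d m B
powers-++ d []      B m = refl
powers-++ d (a ∷ A) B m =
  trans (cong (pow a (d (suc (length A ℕ.+ m))) ++_) (powers-++ d A B m))
        (sym (LP.++-assoc (pow a (d (suc (length A ℕ.+ m)))) _ _))

module _ (k : ℕ) (d : ℕ → ℕ) where

  hist-head : ∀ n → hist k d n ≡ s k d n ∷ drop 1 (hist k d n)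
  hist-head zero    = refl
  hist-head (suc n) = cong (_∷ hist k d n) (sym (LP.++-identityʳ _))

  length-hist : ∀ n → length (hist k d n) ≡ suc n
  length-hist zero    = refl
  length-hist (suc n) = cong suc (length-hist n)

  drop-hist : ∀ i j → drop i (hist k d (i ℕ.+ j)) ≡ hist k d j
  drop-hist zero    j = refl
  drop-hist (suc i) j = drop-hist i j

  s-D-product : ∀ n → 1 ≤ d (suc n) → s k d n ++ D k d n ≡ powers d (suc n) (hist k d n)
  s-D-product n d≥1 = begin
    s k d n ++ (pow (s k d n) (d (suc n) ∸ 1) ++ powers d n (drop 1 (hist k d n)))
      ≡⟨ sym (LP.++-assoc (s k d n) _ _) ⟩
    (s k d n ++ pow (s k d n) (d (suc n) ∸ 1)) ++ powers d n (drop 1 (hist k d n))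
      ≡⟨ cong (_++ powers d n (drop 1 (hist k d n))) (pow-unfold (s k d n) (d (suc n)) d≥1) ⟩
    powers d (suc n) (s k d n ∷ drop 1 (hist k d n))
      ≡⟨ cong (powers d (suc n)) (sym (hist-head n)) ⟩
    powers d (suc n) (hist k d n) ∎

  s-short : ∀ n → suc n < k → s k d (suc n) ≡ powers d (suc n) (hist k d n) ++ suc (suc n) ∷ []
  s-short n n+1<k with suc n <ᵇ k | ℕP.<⇒<ᵇ n+1<k
  ... | true  | _ = LP.++-identityʳ _
  ... | false | ()

  s-long : ∀ k₁ j → k ≡ suc k₁ →
    s k d (suc (k₁ ℕ.+ j)) ≡ powers d (suc (k₁ ℕ.+ j)) (take k₁ (hist k d (k₁ ℕ.+ j))) ++ s k d j
  s-long k₁ j refl with suc (k₁ ℕ.+ j) <ᵇ suc k₁ | ℕP.<ᵇ⇒< (suc (k₁ ℕ.+ j)) (suc k₁)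
  ... | true  | lt = contradiction (lt tt) (ℕP.≤⇒≯ (s≤s (ℕP.m≤m+n k₁ j)))
  ... | false | _  = trans (LP.++-identityʳ _)
                           (cong (λ h → powers d _ (take k₁ (hist k d (k₁ ℕ.+ j))) ++ concat (take 1 h))
                                 (drop-hist k₁ j))

shortRegime : ∀ d → (∀ i → 1 ≤ i → 1 ≤ d i) → ∀ n t → let k = suc (n ℕ.+ suc t) in
  ((pos (s k d (suc n)) ++ Dz k d ((+ n) - (+ k) + 1ℤ)) ≈FG (pos (s k d n) ++ Dz k d (+ n)))
  × (lenD k d (+ n) - lenD k d ((+ n) - (+ k) + 1ℤ) ≡ (+ length (s k d (suc n))) - (+ length (s k d n)))
shortRegime d d≥1 n t rewrite shortIndex n t | shortLetter n t =
  fromLetterIdentity (s k d (suc n)) (s k d n) (D k d n) (suc (suc n)) sₙ₊₁-as-product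
  where
  k = suc (n ℕ.+ suc t)
  n+1<k : suc n < k
  n+1<k = s≤s (ℕP.m<m+n n (s≤s z≤n))
  sₙ₊₁-as-product : s k d (suc n) ≡ (s k d n ++ D k d n) ++ suc (suc n) ∷ []
  sₙ₊₁-as-product = trans (s-short k d n n+1<k)
                          (cong (_++ suc (suc n) ∷ []) (sym (s-D-product k d n (d≥1 (suc n) (s≤s z≤n)))))

longRegime : ∀ d → (∀ i → 1 ≤ i → 1 ≤ d i) → ∀ k₁ j → let k = suc k₁ ; n = k₁ ℕ.+ j in
  ((pos (s k d (suc n)) ++ Dz k d ((+ n) - (+ k) + 1ℤ)) ≈FG (pos (s k d n) ++ Dz k d (+ n)))
  × (lenD k d (+ n) - lenD k d ((+ n) - (+ k) + 1ℤ) ≡ (+ length (s k d (suc n))) - (+ length (s k d n)))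
longRegime d d≥1 k₁ j rewrite longIndex k₁ j =
  fromWordIdentity (s k d (suc n)) (D k d j) (s k d n) (D k d n) wordIdentity
  where
  k = suc k₁
  n = k₁ ℕ.+ j
  recent = take k₁ (hist k d n)
  length-recent : length recent ≡ k₁
  length-recent = trans (LP.length-take k₁ (hist k d n))
    (trans (cong (k₁ ⊓_) (length-hist k d n))
           (ℕP.m≤n⇒m⊓n≡m (ℕP.≤-trans (ℕP.m≤m+n k₁ j) (ℕP.n≤1+n _))))
  -- the exponent index of the older factors starts at j + 1
  exponentShift : length recent ℕ.+ suc j ≡ suc n
  exponentShift = trans (cong (ℕ._+ suc j) length-recent) (ℕP.+-suc k₁ j)
  wordIdentity : s k d (suc n) ++ D k d j ≡ s k d n ++ D k d n
  wordIdentity = begin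
    s k d (suc n) ++ D k d j
      ≡⟨ cong (_++ D k d j) (s-long k d k₁ j refl) ⟩
    (powers d (suc n) recent ++ s k d j) ++ D k d j
      ≡⟨ LP.++-assoc (powers d (suc n) recent) _ _ ⟩
    powers d (suc n) recent ++ (s k d j ++ D k d j)
      ≡⟨ cong (powers d (suc n) recent ++_) (s-D-product k d j (d≥1 (suc j) (s≤s z≤n))) ⟩
    powers d (suc n) recent ++ powers d (suc j) (hist k d j)
      ≡⟨ cong (λ i → powers d i recent ++ powers d (suc j) (hist k d j)) (sym exponentShift) ⟩
    powers d (length recent ℕ.+ suc j) recent ++ powers d (suc j) (hist k d j)
      ≡⟨ sym (powers-++ d recent (hist k d j) (suc j)) ⟩
    powers d (length recent ℕ.+ suc j) (recent ++ hist k d j)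
      ≡⟨ cong₂ (powers d) exponentShift (cong (recent ++_) (sym (drop-hist k d k₁ j))) ⟩
    powers d (suc n) (recent ++ drop k₁ (hist k d n))
      ≡⟨ cong (powers d (suc n)) (LP.take++drop≡id k₁ (hist k d n)) ⟩
    powers d (suc n) (hist k d n)
      ≡⟨ sym (s-D-product k d n (d≥1 (suc n) (s≤s z≤n))) ⟩
    s k d n ++ D k d n ∎

proposition4p2 : (k : ℕ) → 2 ≤ k → (d : ℕ → ℕ) → (∀ i → 1 ≤ i → 1 ≤ d i) → (n : ℕ) →
    ((pos (s k d (suc n)) ++ Dz k d ((+ n) - (+ k) + 1ℤ)) ≈FG (pos (s k d n) ++ Dz k d (+ n)))
    × (lenD k d (+ n) - lenD k d ((+ n) - (+ k) + 1ℤ) ≡ (+ length (s k d (suc n))) - (+ length (s k d n)))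
proposition4p2 (suc k₁) _ d d≥1 n with splitAt n k₁
... | inj₁ (t , refl) = shortRegime d d≥1 n t
... | inj₂ (j , refl) = longRegime d d≥1 k₁ j
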